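{- Let $U$ be a finite set with $|U|\ge 9$ and $f(S)=|S|^4$ for $S\subseteq U$. Then $f$ is not weakly submodular.
   Context: A normalized ($f(\emptyset)=0$), non-negative set function $f$ on a finite universe $U$ is called weakly submodular if for all $S,T\subseteq U$: $|T|f(S)+|S|f(T)\ge |S\cap T|\,f(S\cup T)+|S\cup T|\,f(S\cap T)$. -}

module Defs where

open import Data.Nat using (ℕ; _*_; _+_; _≥_; _^_)
open import Data.Fin.Subset using (Subset; ∣_∣; _∩_; _∪_; ⊥)
open import Data.Product using (_×_)
open import Relation.Binary.PropositionalEquality using (_≡_)

-- A set function on the finite universe U = Fin n, with values in ℕ
-- (non-negativity is therefore automatic).
SetFunction : ℕ → Set
SetFunction n = Subset n → ℕ

Normalized : ∀ {n} → SetFunction n → Set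
Normalized f = f ⊥ ≡ 0

WeaklySubmodular : ∀ {n} → SetFunction n → Set
WeaklySubmodular {n} f =
  Normalized f ×
  ((S T : Subset n) →
    ∣ T ∣ * f S + ∣ S ∣ * f T ≥ ∣ S ∩ T ∣ * f (S ∪ T) + ∣ S ∪ T ∣ * f (S ∩ T))

quartic : ∀ {n} → SetFunction n
quartic S = ∣ S ∣ ^ 4

-- Take two 5-element sets meeting in one point, so |S ∩ T| = 1 and |S ∪ T| = 9.
-- The left side is 5·5⁴ + 5·5⁴ = 6250, while the right side is 1·9⁴ + 9·1⁴ = 6570:
-- the quartic value of the union outweighs everything else. Any universe with at
-- least 9 points contains such a pair.
module Submission where

open import Defs
open import Data.Nat using (ℕ; suc; _+_; _*_; _<_; _≥_; _<?_)
open import Data.Nat.Properties using (<⇒≱; m≤n⇒∃[o]m+o≡n)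
open import Data.Bool using (_∧_; _∨_)
open import Data.Vec using (_∷_; []; _++_)
open import Data.Vec.Properties using (zipWith-++)
open import Data.Fin.Subset using (Subset; ∣_∣; _∩_; _∪_; ⊥; inside; outside)
open import Data.Fin.Subset.Properties using (∣⊥∣≡0; ∩-idem; ∪-idem)
open import Data.Product using (_,_)
open import Relation.Nullary using (¬_)
open import Relation.Nullary.Decidable using (from-yes)
open import Relation.Binary.PropositionalEquality using (_≡_; refl; cong; trans)

¬WeaklySubmodular-witness : ∀ {n} (f : SetFunction n) (S T : Subset n) →
  ∣ T ∣ * f S + ∣ S ∣ * f T < ∣ S ∩ T ∣ * f (S ∪ T) + ∣ S ∪ T ∣ * f (S ∩ T) →
  ¬ WeaklySubmodular f
¬WeaklySubmodular-witness f S T violation (_ , weak) = <⇒≱ violation (weak S T)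

quartic-violation : ∀ {n} (S T : Subset n) →
  ∣ S ∣ ≡ 5 → ∣ T ∣ ≡ 5 → ∣ S ∩ T ∣ ≡ 1 → ∣ S ∪ T ∣ ≡ 9 →
  ∣ T ∣ * quartic S + ∣ S ∣ * quartic T < ∣ S ∩ T ∣ * quartic (S ∪ T) + ∣ S ∪ T ∣ * quartic (S ∩ T)
quartic-violation S T ∣S∣≡5 ∣T∣≡5 ∣S∩T∣≡1 ∣S∪T∣≡9
  rewrite ∣S∣≡5 | ∣T∣≡5 | ∣S∩T∣≡1 | ∣S∪T∣≡9 = from-yes (6250 <? 6570)

pad : ∀ {k} m → Subset k → Subset (k + m)
pad m p = p ++ ⊥ {m}

∣pad∣ : ∀ {k} m (p : Subset k) → ∣ pad m p ∣ ≡ ∣ p ∣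
∣pad∣ m []            = ∣⊥∣≡0 m
∣pad∣ m (outside ∷ p) = ∣pad∣ m p
∣pad∣ m (inside ∷ p)  = cong suc (∣pad∣ m p)

pad-∩ : ∀ {k} m (p q : Subset k) → pad m p ∩ pad m q ≡ pad m (p ∩ q)
pad-∩ m p q = trans (zipWith-++ _∧_ p ⊥ q ⊥) (cong ((p ∩ q) ++_) (∩-idem (⊥ {m})))

pad-∪ : ∀ {k} m (p q : Subset k) → pad m p ∪ pad m q ≡ pad m (p ∪ q)
pad-∪ m p q = trans (zipWith-++ _∨_ p ⊥ q ⊥) (cong ((p ∪ q) ++_) (∪-idem (⊥ {m})))

S₉ T₉ : Subset 9
S₉ = inside  ∷ inside  ∷ inside  ∷ inside  ∷ inside ∷ outside ∷ outside ∷ outside ∷ outside ∷ []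
T₉ = outside ∷ outside ∷ outside ∷ outside ∷ inside ∷ inside  ∷ inside  ∷ inside  ∷ inside  ∷ []

quartic-¬WeaklySubmodular : ∀ m → ¬ WeaklySubmodular (quartic {9 + m})
quartic-¬WeaklySubmodular m =
  ¬WeaklySubmodular-witness quartic S T
    (quartic-violation S T (∣pad∣ m S₉) (∣pad∣ m T₉) ∣S∩T∣≡1 ∣S∪T∣≡9)
  where
  S T : Subset (9 + m)
  S = pad m S₉
  T = pad m T₉

  ∣S∩T∣≡1 : ∣ S ∩ T ∣ ≡ 1
  ∣S∩T∣≡1 = trans (cong ∣_∣ (pad-∩ m S₉ T₉)) (∣pad∣ m (S₉ ∩ T₉))

  ∣S∪T∣≡9 : ∣ S ∪ T ∣ ≡ 9
  ∣S∪T∣≡9 = trans (cong ∣_∣ (pad-∪ m S₉ T₉)) (∣pad∣ m (S₉ ∪ T₉))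

proposition9 : (n : ℕ) → n ≥ 9 → ¬ WeaklySubmodular (quartic {n})
proposition9 n n≥9 with m≤n⇒∃[o]m+o≡n n≥9
... | m , refl = quartic-¬WeaklySubmodular m
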